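{- If $t\geq 2$ and $n\ge 3$, then $\iota(S_{K_n}^t)=(n-1)\cdot n^{t-2}$.
   Context: $K_n$ is the complete graph on vertex set $[n]$. For a graph $G=(V,E)$ and integer $t\ge1$, the generalized Sierpiński graph $S_G^t$ has vertex set $V^t$ (words $u_1\ldots u_t$), and $u=u_1\ldots u_t$, $v=v_1\ldots v_t$ are adjacent iff there is $i\in[t]$ with $u_j=v_j$ for $j<i$, $u_i\ne v_i$ and $u_iv_i\in E$, and $u_j=v_i$, $v_j=u_i$ for all $j>i$. A set $A$ of vertices is isolating if no two vertices outside the closed neighborhood $N[A]$ are adjacent; $\iota$ is the minimum size of an isolating set. -}

module Defs where

open import Data.Nat using (ℕ; _<_)
open import Data.Fin using (Fin; toℕ)
open import Data.Vec using (Vec; lookup)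
open import Data.List using (List)
open import Data.List.Membership.Propositional using (_∈_)
open import Data.Product using (Σ; ∃; _×_)
open import Data.Sum using (_⊎_)
open import Relation.Nullary using (¬_)
open import Relation.Binary.PropositionalEquality using (_≡_; _≢_)

record Graph (n : ℕ) : Set₁ where
  field
    Adj   : Fin n → Fin n → Set
    sym   : ∀ {x y} → Adj x y → Adj y x
    irrefl : ∀ {x} → ¬ Adj x x
open Graph public

K : (n : ℕ) → Graph n
K n = record { Adj = λ x y → x ≢ y ; sym = λ p q → p (Relation.Binary.PropositionalEquality.sym q) ; irrefl = λ p → p Relation.Binary.PropositionalEquality.refl }

-- Vertices of the generalized Sierpinski graph S_G^t: words of length t.
Word : ℕ → ℕ → Set
Word n t = Vec (Fin n) t

SAdj : ∀ {n} (G : Graph n) (t : ℕ) → Word n t → Word n t → Set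
SAdj G t u v = Σ (Fin t) λ i →
    (∀ (j : Fin t) → toℕ j < toℕ i → lookup u j ≡ lookup v j)
  × lookup u i ≢ lookup v i
  × Adj G (lookup u i) (lookup v i)
  × (∀ (j : Fin t) → toℕ i < toℕ j → (lookup u j ≡ lookup v i) × (lookup v j ≡ lookup u i))

module _ {V : Set} (Adjᵥ : V → V → Set) where

  InClosedNbhd : List V → V → Set
  InClosedNbhd A x = ∃ λ a → a ∈ A × (x ≡ a ⊎ Adjᵥ a x)

  Isolating : List V → Set
  Isolating A = ∀ x y → ¬ InClosedNbhd A x → ¬ InClosedNbhd A y → ¬ Adjᵥ x y

-- Group the words of length t by their prefix of length t - 1: each group is a clique
-- p·[n], and S_G^(t+1) is n copies x·S_G^t joined only by the edges x·y^t — y·x^t, so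
-- every vertex has at most one neighbour outside its clique.
-- Lower bound: an isolating set A leaves at most one vertex of each clique outside N[A],
-- while each a ∈ A dominates its clique and at most one more vertex; listing, for every a,
-- its clique with the possibly uncovered vertex replaced by that outside neighbour, and then
-- one vertex per clique, covers all n^t words, so n^t ≤ n |A| + n^(t-1).
-- Upper bound: A = {w c 0 : c ≠ 0} dominates every word not ending in 0, and two words
-- ending in 0 are never adjacent because the last letter of adjacent words always changes.
module Submission where

open import Defs
open import Data.Nat using (ℕ; zero; suc; _≤_; _*_; _+_; _∸_; _^_; z≤n; s≤s)
import Data.Nat.Properties as ℕ
open import Data.Fin using (Fin; toℕ; zero; suc)
import Data.Fin.Properties as Fin
open import Data.Vec using (Vec; []; _∷_; _∷ʳ_; lookup; replicate; head; init; last; initLast)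
import Data.Vec.Properties as Vec
open import Data.List using (List; []; _∷_; length; map; _++_; cartesianProductWith; allFin)
import Data.List.Properties as List
open import Data.List.Membership.Propositional using (_∈_; _─_; find; lose)
open import Data.List.Membership.Propositional.Properties
  using (∈-allFin; ∈-cartesianProductWith⁺; ∈-++⁺ˡ; ∈-++⁺ʳ; ∈-map⁺)
open import Data.List.Relation.Unary.Any using (here; there; index; any?; satisfied)
import Data.List.Relation.Unary.All as All
open import Data.List.Relation.Unary.AllPairs using ([]; _∷_)
open import Data.List.Relation.Unary.Unique.Propositional using (Unique)
import Data.List.Relation.Unary.Unique.Propositional.Properties as Unique
open import Data.List.Relation.Binary.Subset.Propositional using (_⊆_)
open import Data.Product using (Σ; _×_; _,_; proj₁; proj₂)
open import Data.Sum using (_⊎_; inj₁; inj₂)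
open import Data.Empty using (⊥-elim)
open import Function using (_∘_)
open import Relation.Nullary using (¬_; yes; no; ¬?)
open import Relation.Nullary.Decidable using (_×-dec_; _→-dec_; _⊎-dec_; decidable-stable)
import Relation.Unary as U
open import Relation.Binary.Definitions using (Decidable; DecidableEquality)
open import Relation.Binary.PropositionalEquality as ≡ using (_≡_; _≢_; refl; cong; cong₂; subst)

module _ {A : Set} where

  ∈-─ : ∀ {x z} {ys : List A} (x∈ys : x ∈ ys) → z ∈ ys → x ≢ z → z ∈ ys ─ x∈ys
  ∈-─ (here refl)  (here refl)  x≢z = ⊥-elim (x≢z refl)
  ∈-─ (here refl)  (there z∈ys) _   = z∈ys
  ∈-─ (there x∈ys) (here refl)  _   = here refl
  ∈-─ (there x∈ys) (there z∈ys) x≢z = there (∈-─ x∈ys z∈ys x≢z)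

  Unique-⊆⇒length≤ : ∀ {xs ys : List A} → Unique xs → xs ⊆ ys → length xs ≤ length ys
  Unique-⊆⇒length≤ {[]}     _             _     = z≤n
  Unique-⊆⇒length≤ {x ∷ xs} {ys} (x∉xs ∷ xs!) xs⊆ys =
    subst (suc (length xs) ≤_) (≡.sym (List.length-removeAt′ ys (index x∈ys)))
      (s≤s (Unique-⊆⇒length≤ xs! λ z∈xs →
        ∈-─ x∈ys (xs⊆ys (there z∈xs)) (All.lookup x∉xs z∈xs)))
    where x∈ys = xs⊆ys (here refl)

module _ {B : Set} {P : B → Set} (P? : U.Decidable P) where

  firstWitness : B → List B → B
  firstWitness d xs with any? P? xs
  ... | yes ∃P = proj₁ (satisfied ∃P)
  ... | no _   = d

  firstWitness-satisfies : ∀ d {xs b} → b ∈ xs → P b → P (firstWitness d xs)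
  firstWitness-satisfies d {xs} b∈xs Pb with any? P? xs
  ... | yes ∃P = proj₂ (satisfied ∃P)
  ... | no ¬∃P = ⊥-elim (¬∃P (lose b∈xs Pb))

length-cartesianProductWith : ∀ {A B C : Set} (f : A → B → C) xs ys →
  length (cartesianProductWith f xs ys) ≡ length xs * length ys
length-cartesianProductWith f []       ys = refl
length-cartesianProductWith f (x ∷ xs) ys = ≡.trans (List.length-++ (map (f x) ys))
  (cong₂ _+_ (List.length-map (f x) ys) (length-cartesianProductWith f xs ys))

length-allFin : ∀ n → length (allFin n) ≡ n
length-allFin n = List.length-tabulate {n = n} (λ i → i)

init-∷ʳ-last : ∀ {A : Set} {m} (v : Vec A (suc m)) → v ≡ init v ∷ʳ last v
init-∷ʳ-last v = proj₂ (proj₂ (initLast v))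

last-replicate : ∀ {A : Set} m {y : A} → last (replicate (suc m) y) ≡ y
last-replicate zero    = refl
last-replicate (suc m) = last-replicate m

lookup-const⇒≡replicate : ∀ {A : Set} {t} {u : Vec A t} {y} →
  (∀ j → lookup u j ≡ y) → u ≡ replicate t y
lookup-const⇒≡replicate {u = []}    _ = refl
lookup-const⇒≡replicate {u = x ∷ u} h = cong₂ _∷_ (h zero) (lookup-const⇒≡replicate (h ∘ suc))

allWords : (n t : ℕ) → List (Word n t)
allWords n zero    = [] ∷ []
allWords n (suc t) = cartesianProductWith _∷_ (allFin n) (allWords n t)

∈-allWords : ∀ {n t} (w : Word n t) → w ∈ allWords n t
∈-allWords []      = here refl
∈-allWords (x ∷ w) = ∈-cartesianProductWith⁺ _∷_ (∈-allFin x) (∈-allWords w)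

allWords-unique : ∀ n t → Unique (allWords n t)
allWords-unique n zero    = All.[] ∷ []
allWords-unique n (suc t) =
  Unique.cartesianProductWith⁺ _∷_ Vec.∷-injective (Unique.allFin⁺ n) (allWords-unique n t)

length-allWords : ∀ n t → length (allWords n t) ≡ n ^ t
length-allWords n zero    = refl
length-allWords n (suc t) = ≡.trans (length-cartesianProductWith _∷_ (allFin n) (allWords n t))
  (cong₂ _*_ (length-allFin n) (length-allWords n t))

Word-≟ : ∀ {n t} → DecidableEquality (Word n t)
Word-≟ = Vec.≡-dec Fin._≟_

OutsideNeighbour : ∀ {n} (G : Graph n) {m} → Word n (suc m) → Word n (suc m) → Set
OutsideNeighbour G {m} a v = SAdj G (suc m) a v × init a ≢ init v

module _ {n : ℕ} {G : Graph n} where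

  Adj⇒≢ : ∀ {x y} → Adj G x y → x ≢ y
  Adj⇒≢ adj refl = irrefl G adj

  SAdj-∷⁺ : ∀ {t} {u v : Word n t} x → SAdj G t u v → SAdj G (suc t) (x ∷ u) (x ∷ v)
  SAdj-∷⁺ x (i , pre , u≢v , adj , post) = suc i , pre′ , u≢v , adj , post′
    where
    pre′ : ∀ j → suc (toℕ j) ≤ suc (toℕ i) → _
    pre′ zero    _         = refl
    pre′ (suc j) (s≤s j<i) = pre j j<i
    post′ : ∀ j → suc (suc (toℕ i)) ≤ toℕ j → _
    post′ (suc j) (s≤s i<j) = post j i<j

  SAdj-∷⁻ : ∀ {t} {u v : Word n t} {x y} → SAdj G (suc t) (x ∷ u) (y ∷ v) →
            (x ≡ y × SAdj G t u v) ⊎ (Adj G x y × u ≡ replicate t y × v ≡ replicate t x)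
  SAdj-∷⁻ (zero , _ , _ , adj , post) =
    inj₂ ( adj
         , lookup-const⇒≡replicate (λ j → proj₁ (post (suc j) (s≤s z≤n)))
         , lookup-const⇒≡replicate (λ j → proj₂ (post (suc j) (s≤s z≤n))))
  SAdj-∷⁻ (suc i , pre , u≢v , adj , post) =
    inj₁ ( pre zero (s≤s z≤n)
         , i , (λ j j<i → pre (suc j) (s≤s j<i)) , u≢v , adj , (λ j i<j → post (suc j) (s≤s i<j)))

  clique-edge : ∀ {m} (p : Word n m) {x y} → Adj G x y → SAdj G (suc m) (p ∷ʳ x) (p ∷ʳ y)
  clique-edge []      adj = zero , (λ _ ()) , Adj⇒≢ adj , adj , λ { zero () }
  clique-edge (z ∷ p) adj = SAdj-∷⁺ z (clique-edge p adj)

  bridge-edge : ∀ {m} (w : Word n m) {x y} → Adj G x y →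
                SAdj G (suc (suc m)) ((w ∷ʳ x) ∷ʳ y) ((w ∷ʳ y) ∷ʳ x)
  bridge-edge []      adj = zero , (λ _ ()) , Adj⇒≢ adj , adj , λ { (suc zero) _ → refl , refl }
  bridge-edge (z ∷ w) adj = SAdj-∷⁺ z (bridge-edge w adj)

  SAdj⇒Adj-last : ∀ {m} {u v : Word n (suc m)} → SAdj G (suc m) u v → Adj G (last u) (last v)
  SAdj⇒Adj-last {zero} {_ ∷ []} {_ ∷ []} s with SAdj-∷⁻ s
  ... | inj₁ (_ , () , _)
  ... | inj₂ (adj , _) = adj
  SAdj⇒Adj-last {suc m} {_ ∷ _} {_ ∷ _} s with SAdj-∷⁻ s
  ... | inj₁ (_ , s′)            = SAdj⇒Adj-last s′
  ... | inj₂ (adj , refl , refl) =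
    ≡.subst₂ (Adj G) (≡.sym (last-replicate m)) (≡.sym (last-replicate m)) (Graph.sym G adj)

  replicate-neighbours-in-clique : ∀ {m y} {v : Word n (suc m)} →
    SAdj G (suc m) (replicate (suc m) y) v → init (replicate (suc m) y) ≡ init v
  replicate-neighbours-in-clique {zero}  {v = _ ∷ []} _ = refl
  replicate-neighbours-in-clique {suc m} {v = _ ∷ _}  s with SAdj-∷⁻ s
  ... | inj₁ (refl , s′)     = cong (_ ∷_) (replicate-neighbours-in-clique s′)
  ... | inj₂ (adj , y≡z , _) = ⊥-elim (Adj⇒≢ adj (cong head y≡z))

  outside-neighbour-unique : ∀ {m} {a v v′ : Word n (suc m)} →
    OutsideNeighbour G a v → OutsideNeighbour G a v′ → v ≡ v′
  outside-neighbour-unique {zero} {_ ∷ []} {_ ∷ []} (_ , ne) _ = ⊥-elim (ne refl)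
  outside-neighbour-unique {suc m} {x ∷ a} {_ ∷ _} {_ ∷ _} (s , ne) (s′ , ne′)
    with SAdj-∷⁻ s | SAdj-∷⁻ s′
  ... | inj₁ (refl , t) | inj₁ (refl , t′) =
    cong (x ∷_) (outside-neighbour-unique (t , ne ∘ cong (x ∷_)) (t′ , ne′ ∘ cong (x ∷_)))
  ... | inj₁ (refl , t) | inj₂ (_ , refl , _) =
    ⊥-elim (ne (cong (x ∷_) (replicate-neighbours-in-clique t)))
  ... | inj₂ (_ , refl , _) | inj₁ (refl , t′) =
    ⊥-elim (ne′ (cong (x ∷_) (replicate-neighbours-in-clique t′)))
  ... | inj₂ (_ , refl , refl) | inj₂ (_ , y≡z , refl) = cong (_∷ _) (cong head y≡z)

SAdj? : ∀ {n} (G : Graph n) → Decidable (Adj G) → ∀ t → Decidable (SAdj G t)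
SAdj? G Adj? t u v = Fin.any? λ i →
        Fin.all? (λ j → (toℕ j ℕ.<? toℕ i) →-dec (lookup u j Fin.≟ lookup v j))
  ×-dec ¬? (lookup u i Fin.≟ lookup v i)
  ×-dec Adj? (lookup u i) (lookup v i)
  ×-dec Fin.all? (λ j → (toℕ i ℕ.<? toℕ j) →-dec
                         ((lookup u j Fin.≟ lookup v i) ×-dec (lookup v j Fin.≟ lookup u i)))

K-Adj? : ∀ {n} → Decidable (Adj (K n))
K-Adj? x y = ¬? (x Fin.≟ y)

InClosedNbhd? : ∀ {V : Set} {Adjᵥ : V → V → Set} → DecidableEquality V → Decidable Adjᵥ →
  ∀ A → U.Decidable (InClosedNbhd Adjᵥ A)
InClosedNbhd? _≟_ Adj? A x with any? (λ a → (x ≟ a) ⊎-dec Adj? a x) A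
... | yes ∃a = yes (find ∃a)
... | no ¬∃a = no λ (a , a∈A , a∼x) → ¬∃a (lose a∈A a∼x)

module LowerBound {n m : ℕ} (A : List (Word (suc n) (suc m)))
                  (isolating : Isolating (SAdj (K (suc n)) (suc m)) A) where

  open ≡.≡-Reasoning

  S : Word (suc n) (suc m) → Word (suc n) (suc m) → Set
  S = SAdj (K (suc n)) (suc m)

  Covered : Word (suc n) (suc m) → Set
  Covered = InClosedNbhd S A

  Covered? : U.Decidable Covered
  Covered? = InClosedNbhd? Word-≟ (SAdj? (K (suc n)) K-Adj? (suc m)) A

  Uncovered? : ∀ p → U.Decidable (λ y → ¬ Covered (p ∷ʳ y))
  Uncovered? p y = ¬? (Covered? (p ∷ʳ y))

  OutsideNeighbour? : ∀ a → U.Decidable (OutsideNeighbour (K (suc n)) a)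
  OutsideNeighbour? a v = SAdj? (K (suc n)) K-Adj? (suc m) a v ×-dec ¬? (Word-≟ (init a) (init v))

  -- Abstract, so that with-abstractions over these searches do not unfold them.
  abstract
    uncovered : Word (suc n) m → Fin (suc n)
    uncovered p = firstWitness (Uncovered? p) zero (allFin (suc n))

    uncovered-spec : ∀ p {y} → ¬ Covered (p ∷ʳ y) → ¬ Covered (p ∷ʳ uncovered p)
    uncovered-spec p {y} = firstWitness-satisfies (Uncovered? p) zero (∈-allFin y)

    outside : Word (suc n) (suc m) → Word (suc n) (suc m)
    outside a = firstWitness (OutsideNeighbour? a) a (allWords (suc n) (suc m))

    outside-spec : ∀ {a v} → OutsideNeighbour (K (suc n)) a v → outside a ≡ v
    outside-spec {a} {v} o = outside-neighbour-unique {G = K (suc n)}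
      (firstWitness-satisfies (OutsideNeighbour? a) a (∈-allWords v) o) o

  covered-off-uncovered : ∀ p {y} → y ≢ uncovered p → Covered (p ∷ʳ y)
  covered-off-uncovered p {y} y≢σ = decidable-stable (Covered? (p ∷ʳ y)) λ ¬cov →
    isolating (p ∷ʳ y) (p ∷ʳ uncovered p) ¬cov (uncovered-spec p ¬cov)
      (clique-edge {G = K (suc n)} p y≢σ)

  entry : Word (suc n) (suc m) → Fin (suc n) → Word (suc n) (suc m)
  entry a y with y Fin.≟ uncovered (init a)
  ... | yes _ = outside a
  ... | no _  = init a ∷ʳ y

  entry-in-clique : ∀ a {y} → y ≢ uncovered (init a) → entry a y ≡ init a ∷ʳ y
  entry-in-clique a {y} y≢σ with y Fin.≟ uncovered (init a)
  ... | yes y≡σ = ⊥-elim (y≢σ y≡σ)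
  ... | no _    = refl

  entry-outside : ∀ a → entry a (uncovered (init a)) ≡ outside a
  entry-outside a with uncovered (init a) Fin.≟ uncovered (init a)
  ... | yes _  = refl
  ... | no σ≢σ = ⊥-elim (σ≢σ refl)

  entries : List (Word (suc n) (suc m))
  entries = cartesianProductWith entry A (allFin (suc n))

  ∈-entries : ∀ {a v} y → a ∈ A → entry a y ≡ v → v ∈ entries
  ∈-entries y a∈A refl = ∈-cartesianProductWith⁺ entry a∈A (∈-allFin y)

  covered⇒∈-entries : ∀ {v} → Covered v → last v ≢ uncovered (init v) → v ∈ entries
  covered⇒∈-entries {v} (a , a∈A , a∼v) last≢σ with Word-≟ (init a) (init v)
  ... | yes same = ∈-entries (last v) a∈A (begin
    entry a (last v)  ≡⟨ entry-in-clique a (λ e → last≢σ (≡.trans e (cong uncovered same))) ⟩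
    init a ∷ʳ last v  ≡⟨ cong (_∷ʳ last v) same ⟩
    init v ∷ʳ last v  ≡⟨ ≡.sym (init-∷ʳ-last v) ⟩
    v                 ∎)
  ... | no differ = ∈-entries (uncovered (init a)) a∈A
    (≡.trans (entry-outside a) (outside-spec (neighbour a∼v , differ)))
    where
    neighbour : v ≡ a ⊎ S a v → S a v
    neighbour (inj₁ refl) = ⊥-elim (differ refl)
    neighbour (inj₂ a∼v)  = a∼v

  cover : List (Word (suc n) (suc m))
  cover = entries ++ map (λ p → p ∷ʳ uncovered p) (allWords (suc n) m)

  ∈-cover : ∀ v → v ∈ cover
  ∈-cover v with last v Fin.≟ uncovered (init v)
  ... | yes last≡σ =
    ∈-++⁺ʳ entries (subst (_∈ _) (≡.sym v≡) (∈-map⁺ _ (∈-allWords (init v))))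
    where
    v≡ : v ≡ init v ∷ʳ uncovered (init v)
    v≡ = ≡.trans (init-∷ʳ-last v) (cong (init v ∷ʳ_) last≡σ)
  ... | no last≢σ = ∈-++⁺ˡ (covered⇒∈-entries
    (subst Covered (≡.sym (init-∷ʳ-last v)) (covered-off-uncovered (init v) last≢σ)) last≢σ)

  length-cover : length cover ≡ length A * suc n + suc n ^ m
  length-cover = begin
    length cover
      ≡⟨ List.length-++ entries ⟩
    length entries + length (map _ (allWords (suc n) m))
      ≡⟨ cong₂ _+_ (length-cartesianProductWith entry A (allFin (suc n)))
                   (List.length-map _ (allWords (suc n) m)) ⟩
    length A * length (allFin (suc n)) + length (allWords (suc n) m)
      ≡⟨ cong₂ (λ k l → length A * k + l) (length-allFin (suc n)) (length-allWords (suc n) m) ⟩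
    length A * suc n + suc n ^ m
      ∎

  isolating-bound : suc n ^ suc m ≤ length A * suc n + suc n ^ m
  isolating-bound = ≡.subst₂ _≤_ (length-allWords (suc n) (suc m)) length-cover
    (Unique-⊆⇒length≤ (allWords-unique (suc n) (suc m)) (λ {v} _ → ∈-cover v))

module UpperBound (n k : ℕ) where

  open ≡.≡-Reasoning

  S : Word (suc n) (suc (suc k)) → Word (suc n) (suc (suc k)) → Set
  S = SAdj (K (suc n)) (suc (suc k))

  tag : Word (suc n) k → Fin n → Word (suc n) (suc (suc k))
  tag w c = (w ∷ʳ suc c) ∷ʳ zero

  tag-injective : ∀ {w w′ c c′} → tag w c ≡ tag w′ c′ → w ≡ w′ × c ≡ c′
  tag-injective {w} {w′} {c} {c′} eq
    with Vec.∷ʳ-injective (w ∷ʳ suc c) (w′ ∷ʳ suc c′) eq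
  ... | eq′ , _ with Vec.∷ʳ-injective w w′ eq′
  ... | w≡w′ , sc≡sc′ = w≡w′ , Fin.suc-injective sc≡sc′

  isolatingSet : List (Word (suc n) (suc (suc k)))
  isolatingSet = cartesianProductWith tag (allWords (suc n) k) (allFin n)

  isolatingSet-unique : Unique isolatingSet
  isolatingSet-unique =
    Unique.cartesianProductWith⁺ tag tag-injective (allWords-unique (suc n) k) (Unique.allFin⁺ n)

  length-isolatingSet : length isolatingSet ≡ n * suc n ^ k
  length-isolatingSet = begin
    length isolatingSet
      ≡⟨ length-cartesianProductWith tag (allWords (suc n) k) (allFin n) ⟩
    length (allWords (suc n) k) * length (allFin n)
      ≡⟨ cong₂ _*_ (length-allWords (suc n) k) (length-allFin n) ⟩
    suc n ^ k * n
      ≡⟨ ℕ.*-comm (suc n ^ k) n ⟩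
    n * suc n ^ k
      ∎

  Covered : Word (suc n) (suc (suc k)) → Set
  Covered = InClosedNbhd S isolatingSet

  tag∈isolatingSet : ∀ w c → tag w c ∈ isolatingSet
  tag∈isolatingSet w c = ∈-cartesianProductWith⁺ tag (∈-allWords w) (∈-allFin c)

  covered : ∀ w c d → Covered ((w ∷ʳ c) ∷ʳ suc d)
  covered w zero    d =
    tag w d , tag∈isolatingSet w d , inj₂ (bridge-edge {G = K (suc n)} w λ ())
  covered w (suc c) d =
    tag w c , tag∈isolatingSet w c , inj₂ (clique-edge {G = K (suc n)} (w ∷ʳ suc c) λ ())

  uncovered⇒last≡zero : ∀ u → ¬ Covered u → last u ≡ zero
  uncovered⇒last≡zero u ¬cov with last u in last≡
  ... | zero  = refl
  ... | suc d = ⊥-elim (¬cov (subst Covered (≡.sym u≡) (covered (init (init u)) (last (init u)) d)))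
    where
    u≡ : u ≡ (init (init u) ∷ʳ last (init u)) ∷ʳ suc d
    u≡ = ≡.trans (init-∷ʳ-last u) (cong₂ _∷ʳ_ (init-∷ʳ-last (init u)) last≡)

  isolatingSet-isolating : Isolating S isolatingSet
  isolatingSet-isolating x y ¬x ¬y x∼y =
    SAdj⇒Adj-last {G = K (suc n)} {u = x} {v = y} x∼y
      (≡.trans (uncovered⇒last≡zero x ¬x) (≡.sym (uncovered⇒last≡zero y ¬y)))

cancel-power-bound : ∀ n x a → suc n * (suc n * x) ≤ a * suc n + suc n * x → n * x ≤ a
cancel-power-bound n x a bound = ℕ.*-cancelˡ-≤ (suc n) (ℕ.+-cancelˡ-≤ (suc n * x) _ _ (begin
  suc n * x + suc n * (n * x) ≡⟨ ≡.sym (ℕ.*-distribˡ-+ (suc n) x (n * x)) ⟩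
  suc n * (suc n * x)         ≤⟨ bound ⟩
  a * suc n + suc n * x       ≡⟨ ℕ.+-comm (a * suc n) (suc n * x) ⟩
  suc n * x + a * suc n       ≡⟨ cong (suc n * x +_) (ℕ.*-comm a (suc n)) ⟩
  suc n * x + suc n * a       ∎))
  where open ℕ.≤-Reasoning

-- The hypothesis n ≥ 3 is only used as n ≥ 1.
corollary5p4 : (n t : ℕ) → 2 ≤ t → 3 ≤ n →
    (Σ (List (Word n t)) λ A → Unique A × Isolating (SAdj (K n) t) A
        × length A ≡ (n ∸ 1) * n ^ (t ∸ 2))
    × (∀ (A : List (Word n t)) → Unique A → Isolating (SAdj (K n) t) A
        → (n ∸ 1) * n ^ (t ∸ 2) ≤ length A)
corollary5p4 (suc n) (suc (suc k)) (s≤s (s≤s _)) (s≤s _) =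
    (isolatingSet , isolatingSet-unique , isolatingSet-isolating , length-isolatingSet)
  , λ A _ isolating →
      cancel-power-bound n (suc n ^ k) (length A) (LowerBound.isolating-bound A isolating)
  where open UpperBound n k
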